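{- Let $\mathbb{F}$ be a field with $\operatorname{char}(\mathbb{F})\neq2$, $M\in\mathbb{F}^2$, $r\in\mathbb{F}^{*}$, let $P\in C(M,r)_{\mathbb{F}}$ and let $q$ be a perfect distance with respect to $C(M,r)_{\mathbb{F}}$. Then there exists $Q\in C(M,r)_{\mathbb{F}}$ with $D^2(P,Q)=q$. Moreover, there exist two such points $Q_1\neq Q_2$ if and only if $q\neq4r^2$.
   Context: $\boldsymbol{P}(\mathbb{F})$ is the prime subfield of $\mathbb{F}$, $\square_K=\{a^2:a\in K\}$. $C(M,r)_{\mathbb{F}}=\{(x,y)\in\mathbb{F}^2:(x-m_1)^2+(y-m_2)^2=r^2\}$ for $M=(m_1,m_2)$. $D^2((p_1,p_2),(q_1,q_2))=(p_1-q_1)^2+(p_2-q_2)^2$; two points have rational squared distance if their squared distance lies in $\square_{\boldsymbol{P}(\mathbb{F})}$. $q$ is a perfect distance with respect to $C(M,r)_{\mathbb{F}}$ if $q=D^2(A,B)$ for two points $A,B$ on the circle with rational squared distance and there is a third point $X$ on the circle, with $A,B,X$ pairwise different, such that all squared distances among $A,B,X$ are rational. -}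

module Defs where

open import Level using (Level; _⊔_) renaming (suc to lsuc)
open import Algebra.Bundles using (CommutativeRing)
open import Data.Nat using (ℕ; zero; suc)
open import Data.Integer using (ℤ; +_; -[1+_])
open import Data.Product using (_×_; _,_; ∃; Σ)
open import Relation.Nullary using (¬_)

record Field (c ℓ : Level) : Set (lsuc (c ⊔ ℓ)) where
  field
    commutativeRing : CommutativeRing c ℓ
  open CommutativeRing commutativeRing public
  field
    0≉1     : ¬ (0# ≈ 1#)
    inverse : ∀ x → ¬ (x ≈ 0#) → ∃ λ y → x * y ≈ 1#

module FieldDefs {c ℓ : Level} (F : Field c ℓ) where
  open Field F

  CharNot2 : Set ℓ
  CharNot2 = ¬ ((1# + 1#) ≈ 0#)

  fromℕ : ℕ → Carrier
  fromℕ zero    = 0#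
  fromℕ (suc n) = 1# + fromℕ n

  fromℤ : ℤ → Carrier
  fromℤ (+ n)     = fromℕ n
  fromℤ -[1+ n ]  = - fromℕ (suc n)

  -- membership in the prime subfield P(F): the elements a·1 / b·1 with
  -- a, b integers and b·1 ≠ 0 (the subfield generated by 1)
  InPrime : Carrier → Set ℓ
  InPrime x = Σ ℤ λ a → Σ ℤ λ b → ¬ (fromℤ b ≈ 0#) × (x * fromℤ b ≈ fromℤ a)

  PrimeSquare : Carrier → Set (c ⊔ ℓ)
  PrimeSquare x = Σ Carrier λ s → InPrime s × (x ≈ s * s)

  Point : Set c
  Point = Carrier × Carrier

  _≈ₚ_ : Point → Point → Set ℓ
  (a₁ , a₂) ≈ₚ (b₁ , b₂) = (a₁ ≈ b₁) × (a₂ ≈ b₂)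

  D² : Point → Point → Carrier
  D² (p₁ , p₂) (q₁ , q₂) = (p₁ - q₁) * (p₁ - q₁) + (p₂ - q₂) * (p₂ - q₂)

  OnCircle : Point → Carrier → Point → Set ℓ
  OnCircle M r X = D² X M ≈ r * r

  RationalDist : Point → Point → Set (c ⊔ ℓ)
  RationalDist A B = PrimeSquare (D² A B)

  PerfectDistance : Point → Carrier → Carrier → Set (c ⊔ ℓ)
  PerfectDistance M r q =
    Σ Point λ A → Σ Point λ B → Σ Point λ X →
      OnCircle M r A × OnCircle M r B × OnCircle M r X ×
      ¬ (A ≈ₚ B) × ¬ (A ≈ₚ X) × ¬ (B ≈ₚ X) ×
      RationalDist A B × RationalDist A X × RationalDist B X ×
      (q ≈ D² A B)

module Submission where

-- Identify F² with F[i], i² = −1, and let R = r². For A, B on the circle, with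
-- a = A − M and b = B − M, the element ρ = b·ā / R is a unit, and X ↦ M + (X − M)·ρ maps
-- the circle to itself, sends A to B and moves every point of the circle by the same
-- squared distance; hence Q = M + (P − M)·ρ solves D²(P,Q) = q. The conjugate unit (from
-- B to A) gives a second solution, and the two agree only if ρ is real, i.e. a × b = 0;
-- then Lagrange's identity |a|²|b|² = (a·b)² + (a×b)² forces a·b = ±R, where a·b = R
-- means A = B and a·b = −R means q = 4R. Finally, a solution Q of D²(P,Q) = 4R has
-- (P − M)·(Q − M) = −R, and the same equality case of Lagrange's identity makes Q the
-- antipode of P, so that solution is unique.

open import Algebra.Bundles using (CommutativeRing; RawRing)
open import Algebra.Solver.Ring.AlmostCommutativeRing
  using (_-Raw-AlmostCommutative⟶_; fromCommutativeRing)
open import Data.Maybe using (Maybe; just; nothing)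
open import Data.Nat as ℕ using (ℕ)
open import Data.Product using (_×_; _,_; Σ; proj₁; proj₂)
open import Data.Product.Relation.Binary.Pointwise.NonDependent using (Pointwise; ×-setoid)
open import Function.Bundles using (_⇔_; mk⇔)
open import Level using (Level)
open import Relation.Binary.Bundles using (Setoid)
open import Relation.Binary.PropositionalEquality as ≡ using (_≡_)
open import Relation.Nullary using (¬_; yes; no)
open import Relation.Nullary.Negation using (¬¬-map)
open import Defs

-- Algebra.Solver.Ring needs a coefficient ring whose arithmetic computes, mapped
-- homomorphically into the carrier; ℕ cannot express subtraction, so integers are
-- encoded as reduced pairs (a , b), interpreted as a·1 − b·1.
module CommutativeRingSolver {c ℓ : Level} (CR : CommutativeRing c ℓ) where
  open CommutativeRing CR
  open import Algebra.Properties.Ring ring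
    using (-‿+-comm; -0#≈0#; ⁻¹-anti-homo‿-; [y-z]x≈yx-zx; x[y-z]≈xy-xz; //-cong₂)
  open import Algebra.Properties.CommutativeSemigroup +-commutativeSemigroup using (interchange)
  open import Algebra.Properties.Semiring.Mult semiring
    using (×-homo-+; ×1-homo-*) renaming (_×_ to _×ᵣ_)
  open import Relation.Binary.Reasoning.Setoid setoid

  reduce : ℕ → ℕ → ℕ × ℕ
  reduce ℕ.zero    b         = (0 , b)
  reduce (ℕ.suc a) ℕ.zero    = (ℕ.suc a , 0)
  reduce (ℕ.suc a) (ℕ.suc b) = reduce a b

  ℤ-as-ℕ² : RawRing _ _
  ℤ-as-ℕ² = record
    { Carrier = ℕ × ℕ
    ; _≈_     = _≡_
    ; _+_     = λ (a , b) (c , d) → reduce (a ℕ.+ c) (b ℕ.+ d)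
    ; _*_     = λ (a , b) (c , d) → reduce (a ℕ.* c ℕ.+ b ℕ.* d) (a ℕ.* d ℕ.+ b ℕ.* c)
    ; -_      = λ (a , b) → (b , a)
    ; 0#      = (0 , 0)
    ; 1#      = (1 , 0)
    }

  ι : ℕ → Carrier
  ι n = n ×ᵣ 1#

  ⟦_⟧ℤ : ℕ × ℕ → Carrier
  ⟦ (a , b) ⟧ℤ = ι a - ι b

  [x+z]-[y+w]≈[x-y]+[z-w] : ∀ x y z w → (x + z) - (y + w) ≈ (x - y) + (z - w)
  [x+z]-[y+w]≈[x-y]+[z-w] x y z w = begin
    (x + z) - (y + w)      ≈⟨ +-congˡ (-‿+-comm y w) ⟨
    (x + z) + (- y + - w)  ≈⟨ interchange x z (- y) (- w) ⟩
    (x - y) + (z - w)      ∎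

  [xz+yw]-[xw+yz]≈[x-y][z-w] : ∀ x y z w →
    (x * z + y * w) - (x * w + y * z) ≈ (x - y) * (z - w)
  [xz+yw]-[xw+yz]≈[x-y][z-w] x y z w = begin
    (x * z + y * w) - (x * w + y * z)      ≈⟨ +-congˡ (-‿+-comm (x * w) (y * z)) ⟨
    (x * z + y * w) + (- (x * w) - y * z)  ≈⟨ interchange (x * z) (y * w) _ _ ⟩
    (x * z - x * w) + (y * w - y * z)      ≈⟨ +-congˡ (⁻¹-anti-homo‿- (y * z) (y * w)) ⟨
    (x * z - x * w) - (y * z - y * w)      ≈⟨ //-cong₂ (x[y-z]≈xy-xz x z w) (x[y-z]≈xy-xz y z w) ⟨
    x * (z - w) - y * (z - w)              ≈⟨ [y-z]x≈yx-zx (z - w) x y ⟨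
    (x - y) * (z - w)                      ∎

  x+w≈y+z⇒x-y≈z-w : ∀ x y z w → x + w ≈ y + z → x - y ≈ z - w
  x+w≈y+z⇒x-y≈z-w x y z w x+w≈y+z = begin
    x - y                ≈⟨ +-identityʳ (x - y) ⟨
    (x - y) + 0#         ≈⟨ +-congˡ (-‿inverseʳ w) ⟨
    (x - y) + (w - w)    ≈⟨ interchange x (- y) w (- w) ⟩
    (x + w) + (- y - w)  ≈⟨ +-cong x+w≈y+z (-‿+-comm y w) ⟩
    (y + z) - (y + w)    ≈⟨ [x+z]-[y+w]≈[x-y]+[z-w] y y z w ⟩
    (y - y) + (z - w)    ≈⟨ +-congʳ (-‿inverseʳ y) ⟩
    0# + (z - w)         ≈⟨ +-identityˡ (z - w) ⟩
    z - w                ∎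

  ⟦reduce⟧ : ∀ a b → ⟦ reduce a b ⟧ℤ ≈ ⟦ (a , b) ⟧ℤ
  ⟦reduce⟧ ℕ.zero    b         = refl
  ⟦reduce⟧ (ℕ.suc a) ℕ.zero    = refl
  ⟦reduce⟧ (ℕ.suc a) (ℕ.suc b) = begin
    ⟦ reduce a b ⟧ℤ            ≈⟨ ⟦reduce⟧ a b ⟩
    ι a - ι b                  ≈⟨ +-identityˡ (ι a - ι b) ⟨
    0# + (ι a - ι b)           ≈⟨ +-congʳ (-‿inverseʳ 1#) ⟨
    (1# - 1#) + (ι a - ι b)    ≈⟨ [x+z]-[y+w]≈[x-y]+[z-w] 1# 1# (ι a) (ι b) ⟨
    (1# + ι a) - (1# + ι b)    ∎

  homomorphism : ℤ-as-ℕ² -Raw-AlmostCommutative⟶ fromCommutativeRing CR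
  homomorphism = record
    { ⟦_⟧    = ⟦_⟧ℤ
    ; +-homo = λ (a , b) (c , d) → begin
        ⟦ reduce (a ℕ.+ c) (b ℕ.+ d) ⟧ℤ  ≈⟨ ⟦reduce⟧ (a ℕ.+ c) (b ℕ.+ d) ⟩
        ι (a ℕ.+ c) - ι (b ℕ.+ d)        ≈⟨ //-cong₂ (×-homo-+ 1# a c) (×-homo-+ 1# b d) ⟩
        (ι a + ι c) - (ι b + ι d)        ≈⟨ [x+z]-[y+w]≈[x-y]+[z-w] (ι a) (ι b) (ι c) (ι d) ⟩
        ⟦ (a , b) ⟧ℤ + ⟦ (c , d) ⟧ℤ      ∎
    ; *-homo = λ (a , b) (c , d) → begin
        ⟦ reduce (a ℕ.* c ℕ.+ b ℕ.* d) (a ℕ.* d ℕ.+ b ℕ.* c) ⟧ℤ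
          ≈⟨ ⟦reduce⟧ (a ℕ.* c ℕ.+ b ℕ.* d) (a ℕ.* d ℕ.+ b ℕ.* c) ⟩
        ι (a ℕ.* c ℕ.+ b ℕ.* d) - ι (a ℕ.* d ℕ.+ b ℕ.* c)
          ≈⟨ //-cong₂ (×-homo-+ 1# (a ℕ.* c) (b ℕ.* d)) (×-homo-+ 1# (a ℕ.* d) (b ℕ.* c)) ⟩
        (ι (a ℕ.* c) + ι (b ℕ.* d)) - (ι (a ℕ.* d) + ι (b ℕ.* c))
          ≈⟨ //-cong₂ (+-cong (×1-homo-* a c) (×1-homo-* b d))
                      (+-cong (×1-homo-* a d) (×1-homo-* b c)) ⟩
        (ι a * ι c + ι b * ι d) - (ι a * ι d + ι b * ι c)
          ≈⟨ [xz+yw]-[xw+yz]≈[x-y][z-w] (ι a) (ι b) (ι c) (ι d) ⟩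
        ⟦ (a , b) ⟧ℤ * ⟦ (c , d) ⟧ℤ
          ∎
    ; -‿homo = λ (a , b) → sym (⁻¹-anti-homo‿- (ι a) (ι b))
    ; 0-homo = -‿inverseʳ 0#
    ; 1-homo = trans (+-congˡ -0#≈0#) (trans (+-identityʳ (ι 1)) (+-identityʳ 1#))
    }

  _≟ℤ_ : ∀ x y → Maybe (⟦ x ⟧ℤ ≈ ⟦ y ⟧ℤ)
  (a , b) ≟ℤ (c , d) with a ℕ.+ d ℕ.≟ b ℕ.+ c
  ... | no _        = nothing
  ... | yes a+d≡b+c = just (x+w≈y+z⇒x-y≈z-w (ι a) (ι b) (ι c) (ι d) (begin
    ι a + ι d        ≈⟨ ×-homo-+ 1# a d ⟨
    ι (a ℕ.+ d)      ≡⟨ ≡.cong ι a+d≡b+c ⟩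
    ι (b ℕ.+ c)      ≈⟨ ×-homo-+ 1# b c ⟩
    ι b + ι c        ∎))

  open import Algebra.Solver.Ring ℤ-as-ℕ² (fromCommutativeRing CR) homomorphism _≟ℤ_ public
    using (solve; _:=_; _:+_; _:*_; _:-_; :-_)

-- Written once over bare operations so that the same expressions serve both on the
-- carrier and as ring-solver syntax.
module PlaneOperations {a} {A : Set a} (_+_ _*_ : A → A → A) (-_ : A → A) where
  infixl 6 _⊕_ _⊖_ _-_
  infixl 7 _⊙_
  infixr 8 _·_

  _-_ : A → A → A
  x - y = x + (- y)

  _⊕_ _⊖_ _⊙_ : A × A → A × A → A × A
  (x₁ , x₂) ⊕ (y₁ , y₂) = (x₁ + y₁ , x₂ + y₂)
  (x₁ , x₂) ⊖ (y₁ , y₂) = (x₁ - y₁ , x₂ - y₂)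
  (x₁ , x₂) ⊙ (y₁ , y₂) = ((x₁ * y₁) - (x₂ * y₂) , (x₁ * y₂) + (x₂ * y₁))

  _·_ : A → A × A → A × A
  t · (x₁ , x₂) = (t * x₁ , t * x₂)

  norm : A × A → A
  norm (x₁ , x₂) = (x₁ * x₁) + (x₂ * x₂)

  dot cross : A × A → A × A → A
  dot   (x₁ , x₂) (y₁ , y₂) = (x₁ * y₁) + (x₂ * y₂)
  cross (x₁ , x₂) (y₁ , y₂) = (x₁ * y₂) - (x₂ * y₁)

  rotate : A × A → A × A → A × A → A × A
  rotate M ρ X = M ⊕ (X ⊖ M) ⊙ ρ

  antipode : A × A → A × A → A × A
  antipode M P = M ⊖ (P ⊖ M)

module PlaneIdentities {c ℓ : Level} (CR : CommutativeRing c ℓ) where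
  open CommutativeRing CR
  open CommutativeRingSolver CR using (solve; _:=_; _:+_; _:*_; _:-_; :-_)
  open PlaneOperations _+_ _*_ -_ public hiding (_-_)
  open import Algebra.Properties.Ring ring using (//-cong₂)
  private module S {n} = PlaneOperations (_:+_ {n}) _:*_ :-_

  infix 4 _≈²_
  _≈²_ : Carrier × Carrier → Carrier × Carrier → Set ℓ
  _≈²_ = Pointwise _≈_ _≈_

  norm-⊖-comm : ∀ X Y → norm (X ⊖ Y) ≈ norm (Y ⊖ X)
  norm-⊖-comm (x₁ , x₂) (y₁ , y₂) =
    solve 4 (λ x₁ x₂ y₁ y₂ → let X = (x₁ , x₂) ; Y = (y₁ , y₂) in
               S.norm (X S.⊖ Y) := S.norm (Y S.⊖ X))
      refl x₁ x₂ y₁ y₂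

  norm-⊖-congʳ : ∀ X {Y Y′} → Y ≈² Y′ → norm (X ⊖ Y) ≈ norm (X ⊖ Y′)
  norm-⊖-congʳ X (y₁≈y₁′ , y₂≈y₂′) =
    +-cong (*-cong (//-cong₂ refl y₁≈y₁′) (//-cong₂ refl y₁≈y₁′))
           (*-cong (//-cong₂ refl y₂≈y₂′) (//-cong₂ refl y₂≈y₂′))

  cross-⊖-congʳ : ∀ x M {Y Y′} → Y ≈² Y′ → cross x (Y ⊖ M) ≈ cross x (Y′ ⊖ M)
  cross-⊖-congʳ x M (y₁≈y₁′ , y₂≈y₂′) =
    //-cong₂ (*-congˡ (//-cong₂ y₂≈y₂′ refl)) (*-congˡ (//-cong₂ y₁≈y₁′ refl))

  polarisation : ∀ M X Y →
    norm (X ⊖ Y) + (dot (X ⊖ M) (Y ⊖ M) + dot (X ⊖ M) (Y ⊖ M))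
      ≈ norm (X ⊖ M) + norm (Y ⊖ M)
  polarisation (m₁ , m₂) (x₁ , x₂) (y₁ , y₂) =
    solve 6 (λ m₁ m₂ x₁ x₂ y₁ y₂ → let M = (m₁ , m₂) ; X = (x₁ , x₂) ; Y = (y₁ , y₂) in
               S.norm (X S.⊖ Y) :+ (S.dot (X S.⊖ M) (Y S.⊖ M) :+ S.dot (X S.⊖ M) (Y S.⊖ M))
                 := S.norm (X S.⊖ M) :+ S.norm (Y S.⊖ M))
      refl m₁ m₂ x₁ x₂ y₁ y₂

  lagrange : ∀ x y → norm x * norm y ≈ dot x y * dot x y + cross x y * cross x y
  lagrange (x₁ , x₂) (y₁ , y₂) =
    solve 4 (λ x₁ x₂ y₁ y₂ → let x = (x₁ , x₂) ; y = (y₁ , y₂) in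
               S.norm x :* S.norm y := S.dot x y :* S.dot x y :+ S.cross x y :* S.cross x y)
      refl x₁ x₂ y₁ y₂

  cross-antisym : ∀ x y → cross y x ≈ - cross x y
  cross-antisym (x₁ , x₂) (y₁ , y₂) =
    solve 4 (λ x₁ x₂ y₁ y₂ → let x = (x₁ , x₂) ; y = (y₁ , y₂) in
               S.cross y x := :- S.cross x y)
      refl x₁ x₂ y₁ y₂

  norm-· : ∀ t x → norm (t · x) ≈ (t * t) * norm x
  norm-· t (x₁ , x₂) =
    solve 3 (λ t x₁ x₂ → S.norm (t S.· (x₁ , x₂)) := (t :* t) :* S.norm (x₁ , x₂))
      refl t x₁ x₂

  ⊙-dot-cross : ∀ t a b → a ⊙ t · (dot a b , cross a b) ≈² (t * norm a) · b
  ⊙-dot-cross t (a₁ , a₂) (b₁ , b₂) =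
      solve 5 (λ t a₁ a₂ b₁ b₂ → let a = (a₁ , a₂) ; b = (b₁ , b₂) in
                 proj₁ (a S.⊙ t S.· (S.dot a b , S.cross a b)) := proj₁ ((t :* S.norm a) S.· b))
        refl t a₁ a₂ b₁ b₂
    , solve 5 (λ t a₁ a₂ b₁ b₂ → let a = (a₁ , a₂) ; b = (b₁ , b₂) in
                 proj₂ (a S.⊙ t S.· (S.dot a b , S.cross a b)) := proj₂ ((t :* S.norm a) S.· b))
        refl t a₁ a₂ b₁ b₂

  norm·⊖≈dot-cross : ∀ M X Y →
    let x = X ⊖ M ; y = Y ⊖ M ; d = dot x y - norm y ; e = cross x y in
    norm y · (X ⊖ Y) ≈² (proj₁ y * d + proj₂ y * e , proj₂ y * d - proj₁ y * e)
  norm·⊖≈dot-cross (m₁ , m₂) (x₁ , x₂) (y₁ , y₂) =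
      solve 6 (λ m₁ m₂ x₁ x₂ y₁ y₂ →
               let x = (x₁ , x₂) S.⊖ (m₁ , m₂) ; y = (y₁ , y₂) S.⊖ (m₁ , m₂) in
                 S.norm y :* (x₁ :- y₁)
                   := proj₁ y :* (S.dot x y :- S.norm y) :+ proj₂ y :* S.cross x y)
        refl m₁ m₂ x₁ x₂ y₁ y₂
    , solve 6 (λ m₁ m₂ x₁ x₂ y₁ y₂ →
               let x = (x₁ , x₂) S.⊖ (m₁ , m₂) ; y = (y₁ , y₂) S.⊖ (m₁ , m₂) in
                 S.norm y :* (x₂ :- y₂)
                   := proj₂ y :* (S.dot x y :- S.norm y) :- proj₁ y :* S.cross x y)
        refl m₁ m₂ x₁ x₂ y₁ y₂

  norm-rotate-⊖ : ∀ M ρ X → norm (rotate M ρ X ⊖ M) ≈ norm (X ⊖ M) * norm ρ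
  norm-rotate-⊖ (m₁ , m₂) (ρ₁ , ρ₂) (x₁ , x₂) =
    solve 6 (λ m₁ m₂ ρ₁ ρ₂ x₁ x₂ → let M = (m₁ , m₂) ; ρ = (ρ₁ , ρ₂) ; X = (x₁ , x₂) in
               S.norm (S.rotate M ρ X S.⊖ M) := S.norm (X S.⊖ M) :* S.norm ρ)
      refl m₁ m₂ ρ₁ ρ₂ x₁ x₂

  -- |x − x·ρ|² = |x|²·|1 − ρ|², stated without constants: the solver's constants do not
  -- evaluate to 1# definitionally.
  norm-⊖-rotate : ∀ M ρ X →
    norm (X ⊖ rotate M ρ X) + norm (X ⊖ M) * (proj₁ ρ + proj₁ ρ)
      ≈ norm (X ⊖ M) + norm (rotate M ρ X ⊖ M)
  norm-⊖-rotate (m₁ , m₂) (ρ₁ , ρ₂) (x₁ , x₂) =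
    solve 6 (λ m₁ m₂ ρ₁ ρ₂ x₁ x₂ → let M = (m₁ , m₂) ; ρ = (ρ₁ , ρ₂) ; X = (x₁ , x₂) in
               S.norm (X S.⊖ S.rotate M ρ X) :+ S.norm (X S.⊖ M) :* (ρ₁ :+ ρ₁)
                 := S.norm (X S.⊖ M) :+ S.norm (S.rotate M ρ X S.⊖ M))
      refl m₁ m₂ ρ₁ ρ₂ x₁ x₂

  cross-rotate : ∀ M ρ X → cross (X ⊖ M) (rotate M ρ X ⊖ M) ≈ norm (X ⊖ M) * proj₂ ρ
  cross-rotate (m₁ , m₂) (ρ₁ , ρ₂) (x₁ , x₂) =
    solve 6 (λ m₁ m₂ ρ₁ ρ₂ x₁ x₂ → let M = (m₁ , m₂) ; ρ = (ρ₁ , ρ₂) ; X = (x₁ , x₂) in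
               S.cross (X S.⊖ M) (S.rotate M ρ X S.⊖ M) := S.norm (X S.⊖ M) :* ρ₂)
      refl m₁ m₂ ρ₁ ρ₂ x₁ x₂

  norm-antipode-⊖ : ∀ M P → norm (antipode M P ⊖ M) ≈ norm (P ⊖ M)
  norm-antipode-⊖ (m₁ , m₂) (p₁ , p₂) =
    solve 4 (λ m₁ m₂ p₁ p₂ → let M = (m₁ , m₂) ; P = (p₁ , p₂) in
               S.norm (S.antipode M P S.⊖ M) := S.norm (P S.⊖ M))
      refl m₁ m₂ p₁ p₂

  dot-antipode : ∀ M P Q → dot (Q ⊖ M) (antipode M P ⊖ M) ≈ - dot (P ⊖ M) (Q ⊖ M)
  dot-antipode (m₁ , m₂) (p₁ , p₂) (q₁ , q₂) =
    solve 6 (λ m₁ m₂ p₁ p₂ q₁ q₂ → let M = (m₁ , m₂) ; P = (p₁ , p₂) ; Q = (q₁ , q₂) in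
               S.dot (Q S.⊖ M) (S.antipode M P S.⊖ M) := :- S.dot (P S.⊖ M) (Q S.⊖ M))
      refl m₁ m₂ p₁ p₂ q₁ q₂

-- D² X Y and _≈ₚ_ from Defs are definitionally norm (X ⊖ Y) and _≈²_.
module CircleGeometry {f ℓ : Level} (F : Field f ℓ) where
  open Field F
  open FieldDefs F
  open CommutativeRingSolver commutativeRing using (solve; _:=_; _:+_; _:*_; _:-_; :-_)
  open PlaneIdentities commutativeRing public
  open import Algebra.Properties.Ring ring
    using ( -0#≈0#; -‿involutive; -‿distribʳ-*; +-identityʳ-unique; +-inverseˡ-unique
          ; +-cancelʳ; x∙y⁻¹≈ε⇒x≈y; x≈y⇒x∙y⁻¹≈ε; //-cong₂)
  open import Algebra.Properties.Monoid *-monoid using (insertˡ; cancelˡ)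
  open import Algebra.Properties.Semiring.Mult semiring
    using (×-assoc-*; ×-congʳ) renaming (_×_ to _×ᵣ_)
  open import Relation.Binary.Reasoning.Setoid setoid

  module ≈ₚ = Setoid (×-setoid setoid setoid)

  *-cancelˡ-invertible : ∀ {x x⁻¹ y z} → x * x⁻¹ ≈ 1# → x * y ≈ x * z → y ≈ z
  *-cancelˡ-invertible {x} {x⁻¹} {y} {z} xx⁻¹≈1 xy≈xz = begin
    y              ≈⟨ insertˡ x⁻¹x≈1 y ⟩
    x⁻¹ * (x * y)  ≈⟨ *-congˡ xy≈xz ⟩
    x⁻¹ * (x * z)  ≈⟨ cancelˡ x⁻¹x≈1 z ⟩
    z              ∎
    where
    x⁻¹x≈1 : x⁻¹ * x ≈ 1#
    x⁻¹x≈1 = trans (*-comm x⁻¹ x) xx⁻¹≈1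

  x*y≈0⇒y≈0 : ∀ {x y} → ¬ x ≈ 0# → x * y ≈ 0# → y ≈ 0#
  x*y≈0⇒y≈0 {x} x≉0 xy≈0 =
    *-cancelˡ-invertible (proj₂ (inverse x x≉0)) (trans xy≈0 (sym (zeroʳ x)))

  x*x≈0⇒¬¬x≈0 : ∀ {x} → x * x ≈ 0# → ¬ ¬ x ≈ 0#
  x*x≈0⇒¬¬x≈0 xx≈0 x≉0 = x≉0 (x*y≈0⇒y≈0 x≉0 xx≈0)

  x+x≈0⇒x≈0 : CharNot2 → ∀ {x} → x + x ≈ 0# → x ≈ 0#
  x+x≈0⇒x≈0 2≉0 {x} x+x≈0 = x*y≈0⇒y≈0 2≉0 (begin
    (1# + 1#) * x    ≈⟨ distribʳ x 1# 1# ⟩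
    1# * x + 1# * x  ≈⟨ +-cong (*-identityˡ x) (*-identityˡ x) ⟩
    x + x            ≈⟨ x+x≈0 ⟩
    0#               ∎)

  x*x≈y*y⇒x≈-y : ∀ {x y} → x * x ≈ y * y → ¬ x ≈ y → x ≈ - y
  x*x≈y*y⇒x≈-y {x} {y} xx≈yy x≉y = +-inverseˡ-unique x y (x*y≈0⇒y≈0 x-y≉0 (begin
    (x - y) * (x + y)  ≈⟨ solve 2 (λ x y → (x :- y) :* (x :+ y) := x :* x :- y :* y) refl x y ⟩
    x * x - y * y      ≈⟨ x≈y⇒x∙y⁻¹≈ε xx≈yy ⟩
    0#                 ∎))
    where
    x-y≉0 : ¬ x - y ≈ 0#
    x-y≉0 x-y≈0 = x≉y (x∙y⁻¹≈ε⇒x≈y x y x-y≈0)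

  fromℕ4*x≈[x+x]+[x+x] : ∀ x → fromℕ 4 * x ≈ (x + x) + (x + x)
  fromℕ4*x≈[x+x]+[x+x] x = begin
    fromℕ 4 * x               ≈⟨ ×-assoc-* 4 1# x ⟩
    4 ×ᵣ (1# * x)             ≈⟨ ×-congʳ 4 (*-identityˡ x) ⟩
    x + (x + (x + (x + 0#)))  ≈⟨ +-congˡ (+-congˡ (+-congˡ (+-identityʳ x))) ⟩
    x + (x + (x + x))         ≈⟨ regroup x ⟩
    (x + x) + (x + x)         ∎
    where
    regroup : ∀ x → x + (x + (x + x)) ≈ (x + x) + (x + x)
    regroup = solve 1 (λ x → x :+ (x :+ (x :+ x)) := (x :+ x) :+ (x :+ x)) refl

  module Circle (M : Point) (r : Carrier) {k : Carrier} (Rk≈1 : r * r * k ≈ 1#) where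

    R : Carrier
    R = r * r

    R*-cancel : ∀ {x y} → R * x ≈ R * y → x ≈ y
    R*-cancel = *-cancelˡ-invertible Rk≈1

    -- b·ā / R for a = A ⊖ M and b = B ⊖ M, since (dot a b , cross a b) is b·ā.
    rotation : Point → Point → Point
    rotation A B = k · (dot (A ⊖ M) (B ⊖ M) , cross (A ⊖ M) (B ⊖ M))

    norm-rotation : ∀ {A B} → OnCircle M r A → OnCircle M r B → norm (rotation A B) ≈ 1#
    norm-rotation {A} {B} A∈C B∈C = begin
      norm (rotation A B)                                    ≈⟨ norm-· k (dot a b , cross a b) ⟩
      (k * k) * (dot a b * dot a b + cross a b * cross a b)  ≈⟨ *-congˡ (lagrange a b) ⟨
      (k * k) * (norm a * norm b)                            ≈⟨ *-congˡ (*-cong A∈C B∈C) ⟩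
      (k * k) * (R * R)                                      ≈⟨ regroup k R ⟩
      (R * k) * (R * k)                                      ≈⟨ *-cong Rk≈1 Rk≈1 ⟩
      1# * 1#                                                ≈⟨ *-identityˡ 1# ⟩
      1#                                                     ∎
      where
      a b : Point
      a = A ⊖ M
      b = B ⊖ M
      regroup : ∀ k R → (k * k) * (R * R) ≈ (R * k) * (R * k)
      regroup = solve 2 (λ k R → (k :* k) :* (R :* R) := (R :* k) :* (R :* k)) refl

    rotate-rotation : ∀ {A} B → OnCircle M r A → rotate M (rotation A B) A ≈ₚ B
    rotate-rotation {A} B A∈C = m+z≈y (proj₁ a⊙ρ≈b) , m+z≈y (proj₂ a⊙ρ≈b)
      where
      a⊙ρ≈b : (A ⊖ M) ⊙ rotation A B ≈² (k * D² A M) · (B ⊖ M)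
      a⊙ρ≈b = ⊙-dot-cross k (A ⊖ M) (B ⊖ M)
      kR≈1 : k * D² A M ≈ 1#
      kR≈1 = trans (*-congˡ A∈C) (trans (*-comm k R) Rk≈1)
      m+z≈y : ∀ {m y z} → z ≈ (k * D² A M) * (y - m) → m + z ≈ y
      m+z≈y {m} {y} {z} z≈ = begin
        m + z        ≈⟨ +-congˡ (trans z≈ (trans (*-congʳ kR≈1) (*-identityˡ (y - m)))) ⟩
        m + (y - m)  ≈⟨ solve 2 (λ m y → m :+ (y :- m) := y) refl m y ⟩
        y            ∎

    rotate-onCircle : ∀ {ρ X} → norm ρ ≈ 1# → OnCircle M r X → OnCircle M r (rotate M ρ X)
    rotate-onCircle {ρ} {X} ρ-unit X∈C = begin
      D² (rotate M ρ X) M  ≈⟨ norm-rotate-⊖ M ρ X ⟩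
      D² X M * norm ρ      ≈⟨ *-cong X∈C ρ-unit ⟩
      R * 1#               ≈⟨ *-identityʳ R ⟩
      R                    ∎

    D²-rotate-onCircle : ∀ {ρ X} → norm ρ ≈ 1# → OnCircle M r X →
      D² X (rotate M ρ X) + R * (proj₁ ρ + proj₁ ρ) ≈ R + R
    D²-rotate-onCircle {ρ} {X} ρ-unit X∈C = begin
      D² X (rotate M ρ X) + R * (proj₁ ρ + proj₁ ρ)       ≈⟨ +-congˡ (*-congʳ X∈C) ⟨
      D² X (rotate M ρ X) + D² X M * (proj₁ ρ + proj₁ ρ)  ≈⟨ norm-⊖-rotate M ρ X ⟩
      D² X M + D² (rotate M ρ X) M                        ≈⟨ +-cong X∈C (rotate-onCircle ρ-unit X∈C) ⟩
      R + R                                               ∎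

    D²-rotate-rotation : ∀ {P A B} → OnCircle M r P → OnCircle M r A → OnCircle M r B →
      D² P (rotate M (rotation A B) P) ≈ D² A B
    D²-rotate-rotation {P} {A} {B} P∈C A∈C B∈C = begin
      D² P (rotate M ρ P)  ≈⟨ +-cancelʳ (R * (proj₁ ρ + proj₁ ρ)) _ _
                                (trans (D²-rotate-onCircle ρ-unit P∈C)
                                       (sym (D²-rotate-onCircle ρ-unit A∈C))) ⟩
      D² A (rotate M ρ A)  ≈⟨ norm-⊖-congʳ A (rotate-rotation B A∈C) ⟩
      D² A B               ∎
      where
      ρ : Point
      ρ = rotation A B
      ρ-unit : norm ρ ≈ 1#
      ρ-unit = norm-rotation A∈C B∈C

    dot≈R⇒cross≈0⇒≈ₚ : ∀ {X Y} → OnCircle M r Y →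
      dot (X ⊖ M) (Y ⊖ M) ≈ R → cross (X ⊖ M) (Y ⊖ M) ≈ 0# → X ≈ₚ Y
    dot≈R⇒cross≈0⇒≈ₚ {X} {Y} Y∈C d≈R e≈0 =
        coordinates-agree (proj₁ X-Y≈)
          (trans (+-cong (≈0⇒*≈0 d-R≈0) (≈0⇒*≈0 e≈0)) (+-identityʳ 0#))
      , coordinates-agree (proj₂ X-Y≈)
          (trans (//-cong₂ (≈0⇒*≈0 d-R≈0) (≈0⇒*≈0 e≈0)) (trans (+-congˡ -0#≈0#) (+-identityʳ 0#)))
      where
      x y : Point
      x = X ⊖ M
      y = Y ⊖ M
      X-Y≈ : norm y · (X ⊖ Y) ≈² ( proj₁ y * (dot x y - norm y) + proj₂ y * cross x y
                                 , proj₂ y * (dot x y - norm y) - proj₁ y * cross x y)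
      X-Y≈ = norm·⊖≈dot-cross M X Y
      d-R≈0 : dot x y - norm y ≈ 0#
      d-R≈0 = x≈y⇒x∙y⁻¹≈ε (trans d≈R (sym Y∈C))
      ≈0⇒*≈0 : ∀ {a u} → u ≈ 0# → a * u ≈ 0#
      ≈0⇒*≈0 {a} u≈0 = trans (*-congˡ u≈0) (zeroʳ a)
      coordinates-agree : ∀ {u v w} → norm y * (u - v) ≈ w → w ≈ 0# → u ≈ v
      coordinates-agree {u} {v} eq w≈0 = x∙y⁻¹≈ε⇒x≈y u v
        (R*-cancel (trans (*-congʳ (sym Y∈C)) (trans eq (trans w≈0 (sym (zeroʳ R))))))

    -- Equality in F is not decidable, so x * x ≈ 0# only gives ¬ ¬ x ≈ 0#; this suffices
    -- because every use has a negative goal.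
    dot≈R⇒¬¬≈ₚ : ∀ {X Y} → OnCircle M r X → OnCircle M r Y → dot (X ⊖ M) (Y ⊖ M) ≈ R → ¬ ¬ X ≈ₚ Y
    dot≈R⇒¬¬≈ₚ {X} {Y} X∈C Y∈C d≈R =
      ¬¬-map (dot≈R⇒cross≈0⇒≈ₚ Y∈C d≈R) (x*x≈0⇒¬¬x≈0 (+-identityʳ-unique (R * R) _ (begin
        R * R + cross x y * cross x y              ≈⟨ +-congʳ (*-cong d≈R d≈R) ⟨
        dot x y * dot x y + cross x y * cross x y  ≈⟨ lagrange x y ⟨
        norm x * norm y                            ≈⟨ *-cong X∈C Y∈C ⟩
        R * R                                      ∎)))
      where
      x y : Point
      x = X ⊖ M
      y = Y ⊖ M

    dot≈-R⇒D²≈4R : ∀ {X Y} → OnCircle M r X → OnCircle M r Y →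
      dot (X ⊖ M) (Y ⊖ M) ≈ - R → D² X Y ≈ fromℕ 4 * R
    dot≈-R⇒D²≈4R {X} {Y} X∈C Y∈C d≈-R = begin
      D² X Y                        ≈⟨ x≈[x+y]-y (D² X Y) (d + d) ⟩
      (D² X Y + (d + d)) - (d + d)  ≈⟨ //-cong₂ (trans (polarisation M X Y) (+-cong X∈C Y∈C))
                                                (+-cong d≈-R d≈-R) ⟩
      (R + R) - (- R + - R)         ≈⟨ [x+x]-[-x+-x]≈[x+x]+[x+x] R ⟩
      (R + R) + (R + R)             ≈⟨ fromℕ4*x≈[x+x]+[x+x] R ⟨
      fromℕ 4 * R                   ∎
      where
      d : Carrier
      d = dot (X ⊖ M) (Y ⊖ M)
      x≈[x+y]-y : ∀ x y → x ≈ (x + y) - y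
      x≈[x+y]-y = solve 2 (λ x y → x := (x :+ y) :- y) refl
      [x+x]-[-x+-x]≈[x+x]+[x+x] : ∀ x → (x + x) - (- x + - x) ≈ (x + x) + (x + x)
      [x+x]-[-x+-x]≈[x+x]+[x+x] =
        solve 1 (λ x → (x :+ x) :- (:- x :+ :- x) := (x :+ x) :+ (x :+ x)) refl

    D²≈4R⇒dot≈-R : CharNot2 → ∀ {X Y} → OnCircle M r X → OnCircle M r Y →
      D² X Y ≈ fromℕ 4 * R → dot (X ⊖ M) (Y ⊖ M) ≈ - R
    D²≈4R⇒dot≈-R 2≉0 {X} {Y} X∈C Y∈C XY≈4R = +-inverseˡ-unique d R (x+x≈0⇒x≈0 2≉0 (begin
      (d + R) + (d + R)
        ≈⟨ solve 3 (λ D d R → (d :+ R) :+ (d :+ R)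
                              := ((D :+ (d :+ d)) :- (R :+ R)) :+ (((R :+ R) :+ (R :+ R)) :- D))
             refl (D² X Y) d R ⟩
      ((D² X Y + (d + d)) - (R + R)) + (((R + R) + (R + R)) - D² X Y)
        ≈⟨ +-cong (x≈y⇒x∙y⁻¹≈ε (trans (polarisation M X Y) (+-cong X∈C Y∈C)))
                  (x≈y⇒x∙y⁻¹≈ε (sym (trans XY≈4R (fromℕ4*x≈[x+x]+[x+x] R)))) ⟩
      0# + 0#
        ≈⟨ +-identityʳ 0# ⟩
      0# ∎))
      where
      d : Carrier
      d = dot (X ⊖ M) (Y ⊖ M)

    D²≈4R⇒¬¬≈antipode : CharNot2 → ∀ {P Q} → OnCircle M r P → OnCircle M r Q →
      D² P Q ≈ fromℕ 4 * R → ¬ ¬ Q ≈ₚ antipode M P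
    D²≈4R⇒¬¬≈antipode 2≉0 {P} {Q} P∈C Q∈C PQ≈4R =
      dot≈R⇒¬¬≈ₚ Q∈C (trans (norm-antipode-⊖ M P) P∈C) (begin
        dot (Q ⊖ M) (antipode M P ⊖ M)  ≈⟨ dot-antipode M P Q ⟩
        - dot (P ⊖ M) (Q ⊖ M)           ≈⟨ -‿cong (D²≈4R⇒dot≈-R 2≉0 P∈C Q∈C PQ≈4R) ⟩
        - - R                           ≈⟨ -‿involutive R ⟩
        R                               ∎)

    D²≈4R⇒¬¬≈ₚ : CharNot2 → ∀ {P Q Q′} → OnCircle M r P → OnCircle M r Q → OnCircle M r Q′ →
      D² P Q ≈ fromℕ 4 * R → D² P Q′ ≈ fromℕ 4 * R → ¬ ¬ Q ≈ₚ Q′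
    D²≈4R⇒¬¬≈ₚ 2≉0 P∈C Q∈C Q′∈C PQ≈4R PQ′≈4R Q≉Q′ =
      D²≈4R⇒¬¬≈antipode 2≉0 P∈C Q∈C PQ≈4R λ Q≈P* →
      D²≈4R⇒¬¬≈antipode 2≉0 P∈C Q′∈C PQ′≈4R λ Q′≈P* →
      Q≉Q′ (≈ₚ.trans Q≈P* (≈ₚ.sym Q′≈P*))

    rotations-agree⇒cross≈0 : CharNot2 → ∀ {P A B} → OnCircle M r P →
      rotate M (rotation A B) P ≈ₚ rotate M (rotation B A) P → cross (A ⊖ M) (B ⊖ M) ≈ 0#
    rotations-agree⇒cross≈0 2≉0 {P} {A} {B} P∈C Q₁≈Q₂ =
      *-cancelˡ-invertible (trans (*-comm k R) Rk≈1) (trans kc≈0 (sym (zeroʳ k)))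
      where
      c : Carrier
      c = cross (A ⊖ M) (B ⊖ M)
      kc≈-kc : k * c ≈ - (k * c)
      kc≈-kc = R*-cancel (begin
        R * (k * c)                                    ≈⟨ *-congʳ P∈C ⟨
        D² P M * (k * c)                               ≈⟨ cross-rotate M (rotation A B) P ⟨
        cross (P ⊖ M) (rotate M (rotation A B) P ⊖ M)  ≈⟨ cross-⊖-congʳ (P ⊖ M) M Q₁≈Q₂ ⟩
        cross (P ⊖ M) (rotate M (rotation B A) P ⊖ M)  ≈⟨ cross-rotate M (rotation B A) P ⟩
        D² P M * (k * cross (B ⊖ M) (A ⊖ M))           ≈⟨ *-cong P∈C (*-congˡ (cross-antisym _ _)) ⟩
        R * (k * - c)                                  ≈⟨ *-congˡ (-‿distribʳ-* k c) ⟨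
        R * - (k * c)                                  ∎)
      kc≈0 : k * c ≈ 0#
      kc≈0 = x+x≈0⇒x≈0 2≉0 (trans (+-congˡ kc≈-kc) (-‿inverseʳ (k * c)))

    cross≈0⇒D²≈4R : ∀ {A B} → OnCircle M r A → OnCircle M r B → ¬ A ≈ₚ B →
      cross (A ⊖ M) (B ⊖ M) ≈ 0# → D² A B ≈ fromℕ 4 * R
    cross≈0⇒D²≈4R {A} {B} A∈C B∈C A≉B c≈0 = dot≈-R⇒D²≈4R A∈C B∈C (x*x≈y*y⇒x≈-y d²≈R² d≉R)
      where
      a b : Point
      a = A ⊖ M
      b = B ⊖ M
      d²≈R² : dot a b * dot a b ≈ R * R
      d²≈R² = begin
        dot a b * dot a b                          ≈⟨ +-identityʳ (dot a b * dot a b) ⟨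
        dot a b * dot a b + 0#                     ≈⟨ +-congˡ (trans (*-congˡ c≈0) (zeroʳ _)) ⟨
        dot a b * dot a b + cross a b * cross a b  ≈⟨ lagrange a b ⟨
        norm a * norm b                            ≈⟨ *-cong A∈C B∈C ⟩
        R * R                                      ∎
      d≉R : ¬ dot a b ≈ R
      d≉R d≈R = dot≈R⇒¬¬≈ₚ A∈C B∈C d≈R A≉B

    rotations-differ : CharNot2 → ∀ {P A B} → OnCircle M r P → OnCircle M r A → OnCircle M r B →
      ¬ A ≈ₚ B → ¬ D² A B ≈ fromℕ 4 * R → ¬ rotate M (rotation A B) P ≈ₚ rotate M (rotation B A) P
    rotations-differ 2≉0 P∈C A∈C B∈C A≉B AB≉4R Q₁≈Q₂ =
      AB≉4R (cross≈0⇒D²≈4R A∈C B∈C A≉B (rotations-agree⇒cross≈0 2≉0 P∈C Q₁≈Q₂))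

mainTheorem13 : {c ℓ : Level} (F : Field c ℓ) →
    let open Field F
        open FieldDefs F
    in CharNot2 → (M : Point) → (r : Carrier) → ¬ (r ≈ 0#) →
       (P : Point) → OnCircle M r P →
       (q : Carrier) → PerfectDistance M r q →
       (Σ Point λ Q → OnCircle M r Q × (D² P Q ≈ q)) ×
       ((Σ Point λ Q₁ → Σ Point λ Q₂ →
           OnCircle M r Q₁ × OnCircle M r Q₂ ×
           (D² P Q₁ ≈ q) × (D² P Q₂ ≈ q) × ¬ (Q₁ ≈ₚ Q₂))
        ⇔ (¬ (q ≈ fromℕ 4 * (r * r))))
mainTheorem13 F 2≉0 M r r≉0 P P∈C q (A , B , _ , A∈C , B∈C , _ , A≉B , _ , _ , _ , _ , _ , q≈AB) =
    (Q₁ , Q₁∈C , PQ₁≈q)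
  , mk⇔ (λ (Q , Q′ , Q∈C , Q′∈C , PQ≈q , PQ′≈q , Q≉Q′) q≈4R →
           D²≈4R⇒¬¬≈ₚ 2≉0 P∈C Q∈C Q′∈C (trans PQ≈q q≈4R) (trans PQ′≈q q≈4R) Q≉Q′)
        (λ q≉4R → Q₁ , Q₂ , Q₁∈C , Q₂∈C , PQ₁≈q , PQ₂≈q ,
           rotations-differ 2≉0 P∈C A∈C B∈C A≉B (λ AB≈4R → q≉4R (trans q≈AB AB≈4R)))
  where
  open Field F
  open FieldDefs F
  open CircleGeometry F
  r*r≉0 : ¬ r * r ≈ 0#
  r*r≉0 rr≈0 = x*x≈0⇒¬¬x≈0 rr≈0 r≉0
  open Circle M r (proj₂ (inverse (r * r) r*r≉0))
  Q₁ Q₂ : Point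
  Q₁ = rotate M (rotation A B) P
  Q₂ = rotate M (rotation B A) P
  Q₁∈C : OnCircle M r Q₁
  Q₁∈C = rotate-onCircle (norm-rotation A∈C B∈C) P∈C
  Q₂∈C : OnCircle M r Q₂
  Q₂∈C = rotate-onCircle (norm-rotation B∈C A∈C) P∈C
  PQ₁≈q : D² P Q₁ ≈ q
  PQ₁≈q = trans (D²-rotate-rotation P∈C A∈C B∈C) (sym q≈AB)
  PQ₂≈q : D² P Q₂ ≈ q
  PQ₂≈q = trans (D²-rotate-rotation P∈C B∈C A∈C) (trans (norm-⊖-comm B A) (sym q≈AB))
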